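{- Let $k,d$ be positive integers and $m\ge m_0(k,d)$. Let $\mathfrak{S}$ be a partition of $[0,k]^d$ such that $\{(0)^d\}\in\mathfrak{S}$ and $p^a_{\beta,\gamma}(m)=p^{a'}_{\beta,\gamma}(m)$ for all $\alpha,\beta,\gamma\in\mathfrak{S}$ and all $a,a'\in\alpha$. Let $\alpha\in\mathfrak{S}$ be minimal. Then $D_\alpha=\alpha\cup\{(0)^d\}$; the elements of $\alpha^*$ have pairwise disjoint supports, all of the same size; and either $\mathrm{wt}(\alpha)=1$ or $\alpha^*\subseteq\{0,k\}^d$.
   Context: Notation for vectors in $[0,k]^d=\{0,\dots,k\}^d$: $a\le b$ iff $a_i\le b_i$ for all $i$ ($b$ dominates $a$); $\mathrm{wt}(a)=a_1+\dots+a_d$; $\mathrm{supp}(a)=\{i:a_i>0\}$; $(x)^d=(x,\dots,x)$; $[a]=\{b\in[0,k]^d:b\le a\}$. For nonempty $S\subseteq[0,k]^d$, $\mathrm{wt}(S)=\max\{\mathrm{wt}(b):b\in S\}$. For $\beta\in\mathfrak{S}$, $\beta^*$ is the set of elements of $\beta$ of maximal weight and $D_\beta=\bigcup_{a\in\beta^*}[a]$. On $\mathfrak{S}$ define $\alpha\preceq\beta$ iff every $a\in\alpha$ is dominated by some $b\in\beta$ (a partial order); $\alpha$ is minimal if it is a minimal element of $(\mathfrak{S}\setminus\{\{(0)^d\}\},\preceq)$. Structure constants: for $0\le a,b,c\le k$, $p^a_{b,c}(m)=\sum_i\binom{k-a}{i}\binom{a}{k-b-i}\binom{a}{k-c-i}\binom{m-k-a}{b+c+i-k}$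 (the intersection numbers of the Johnson scheme $\mathcal{J}(m,k)$, a polynomial in $m$); for $a,b,c\in[0,k]^d$, $p^a_{b,c}(m)=\prod_i p^{a_i}_{b_i,c_i}(m)$; for $\beta,\gamma\subseteq[0,k]^d$, $p^a_{\beta,\gamma}(m)=\sum_{b\in\beta,c\in\gamma}p^a_{b,c}(m)$. The constant $m_0(k,d)\ge3k$ is chosen so that for $m\ge m_0(k,d)$, for all $\beta,\gamma\subseteq[0,k]^d$ and $a,a'\in[0,k]^d$, the numerical equality $p^a_{\beta,\gamma}(m)=p^{a'}_{\beta,\gamma}(m)$ implies equality of these as polynomials in $m$. -}

module Defs where

open import Data.Nat using (ℕ; zero; suc; _+_; _*_; _∸_; _≤_; _≤ᵇ_; _⊔_)
open import Data.Nat.Combinatorics using (_C_)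
open import Data.Bool using (Bool; true; false; if_then_else_)
open import Data.Fin using (Fin; toℕ)
import Data.Fin as Fin
open import Data.Vec using (Vec; []; _∷_; lookup; replicate)
open import Data.List using (List; []; _∷_; map; concatMap; upTo; foldr)
open import Data.Nat.ListAction using (sum)
open import Data.List using () renaming (allFin to allFinL)
open import Data.Product using (Σ; _×_; ∃; ∃-syntax)
open import Data.Sum using (_⊎_)
open import Relation.Binary.PropositionalEquality using (_≡_; _≢_)
open import Relation.Nullary using (¬_)
open import Function.Bundles using (_⇔_)

Pt : ℕ → ℕ → Set
Pt k d = Vec (Fin (suc k)) d

zeros : ∀ {k d} → Pt k d
zeros {d = d} = replicate d Fin.zero

Subset : ℕ → ℕ → Set
Subset k d = Pt k d → Bool

_∈S_ : ∀ {k d} → Pt k d → Subset k d → Set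
x ∈S S = S x ≡ true

_≐_ : ∀ {k d} → Subset k d → Subset k d → Set
S ≐ T = ∀ x → S x ≡ T x

allPts : ∀ k d → List (Pt k d)
allPts k zero = [] ∷ []
allPts k (suc d) = concatMap (λ x → map (x ∷_) (allPts k d)) (allFinL (suc k))

_≤v_ : ∀ {k d} → Pt k d → Pt k d → Set
a ≤v b = ∀ i → toℕ (lookup a i) ≤ toℕ (lookup b i)

wt : ∀ {k d} → Pt k d → ℕ
wt [] = 0
wt (x ∷ a) = toℕ x + wt a

InSupp : ∀ {k d} → Pt k d → Fin d → Set
InSupp a i = 1 ≤ toℕ (lookup a i)

suppSize : ∀ {k d} → Pt k d → ℕ
suppSize [] = 0
suppSize (Fin.zero ∷ a) = suppSize a
suppSize (Fin.suc _ ∷ a) = suc (suppSize a)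

wtS : ∀ {k d} → Subset k d → ℕ
wtS {k} {d} S = foldr (λ b r → (if S b then wt b else 0) ⊔ r) 0 (allPts k d)

_∈*_ : ∀ {k d} → Pt k d → Subset k d → Set
a ∈* S = a ∈S S × wt a ≡ wtS S

_∈D_ : ∀ {k d} → Pt k d → Subset k d → Set
x ∈D S = ∃[ a ] (a ∈* S × x ≤v a)

_⪯_ : ∀ {k d} → Subset k d → Subset k d → Set
α ⪯ β = ∀ a → a ∈S α → ∃[ b ] (b ∈S β × a ≤v b)

IsZeroSet : ∀ {k d} → Subset k d → Set
IsZeroSet S = ∀ x → (x ∈S S) ⇔ (x ≡ zeros)

record IsPartition {k d n : ℕ} (𝔖 : Fin n → Subset k d) : Set where
  field
    nonempty : ∀ i → ∃[ x ] (x ∈S 𝔖 i)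
    disjoint : ∀ i j → i ≢ j → ∀ x → x ∈S 𝔖 i → ¬ (x ∈S 𝔖 j)
    covers   : ∀ x → ∃[ i ] (x ∈S 𝔖 i)

Minimal : ∀ {k d n} → (Fin n → Subset k d) → Fin n → Set
Minimal 𝔖 i = ¬ IsZeroSet (𝔖 i)
  × (∀ j → ¬ IsZeroSet (𝔖 j) → 𝔖 j ⪯ 𝔖 i → 𝔖 j ≐ 𝔖 i)

-- binomial (n choose (x - y)), which is 0 when x - y < 0
Cdiff : ℕ → ℕ → ℕ → ℕ
Cdiff n x y = if y ≤ᵇ x then n C (x ∸ y) else 0

-- p^a_{b,c}(m) = Σ_i C(k-a,i) C(a,k-b-i) C(a,k-c-i) C(m-k-a, b+c+i-k)
-- (terms vanish unless 0 ≤ i ≤ k - a)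
pJ : ℕ → ℕ → ℕ → ℕ → ℕ → ℕ
pJ k m a b c = sum (map (λ i →
    ((k ∸ a) C i) * Cdiff a k (b + i) * Cdiff a k (c + i)
      * Cdiff (m ∸ k ∸ a) (b + c + i) k)
  (upTo (suc k)))

pV : ∀ {k d} → ℕ → Pt k d → Pt k d → Pt k d → ℕ
pV m [] [] [] = 1
pV {k} m (a ∷ as) (b ∷ bs) (c ∷ cs) = pJ k m (toℕ a) (toℕ b) (toℕ c) * pV m as bs cs

pS : ∀ {k d} → ℕ → Pt k d → Subset k d → Subset k d → ℕ
pS {k} {d} m a β γ = sum (map (λ b → sum (map (λ c →
    if β b then (if γ c then pV m a b c else 0) else 0)
  (allPts k d))) (allPts k d))

-- equality of p^a_{β,γ} and p^{a'}_{β,γ} as polynomials in m: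
-- agreement at every m' ≥ 2k (where the ℕ-valued formula coincides with
-- the polynomial; two polynomials agreeing at infinitely many points are equal)
PolyEq : ∀ {k d} → Pt k d → Pt k d → Subset k d → Subset k d → Set
PolyEq {k} a a' β γ = ∀ m' → k + k ≤ m' → pS m' a β γ ≡ pS m' a' β γ

ValidM0 : ℕ → ℕ → ℕ → Set
ValidM0 k d m₀ = (k + k + k ≤ m₀)
  × (∀ m → m₀ ≤ m → ∀ (β γ : Subset k d) (a a' : Pt k d)
       → pS m a β γ ≡ pS m a' β γ → PolyEq a a' β γ)

module Submission where

-- For fixed y, p^y_{α,α}(m) is a polynomial in m of degree wt α. Only the pairs (a, a) with
-- a ∈ α* reach that degree, so, up to the factor (k!)^d, its leading coefficient is
-- Σ_{a ∈ α*} Π_t C(k − y_t, k − a_t)·k!/a_t!, and the summand for a is positive iff y ≤ a and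
-- is smallest at y = a. Because m ≥ m₀ upgrades the hypothesis to identities of polynomials,
-- this coefficient is constant on each block. Hence a block containing a nonzero point of D_α
-- is ⪯ α, so equals α by minimality, and α ⊆ D_α. Comparing the coefficients at a ∈ α* and at
-- a unit vector e_t ≤ a (which lies in α) forces every factor C(k − (e_t)_s, k − a_s) to be 1,
-- so the entries of a lie in {0, 1, k} with 1 only when wt a = 1, and no other element of α*
-- can have t in its support.

open import Data.Bool using (true; false; if_then_else_; _∧_)
open import Data.Bool.Properties using (T-≡)
open import Data.Empty using (⊥-elim)
open import Data.Fin using (Fin; toℕ; fromℕ<) renaming (zero to fzero; suc to fsuc)
import Data.Fin.Properties as Fin
open import Data.List using (List; []; _∷_; map; upTo; _++_; [_]; concatMap; foldr)
  renaming (allFin to allFinL)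
open import Data.List.Properties using (map-++; upTo-∷ʳ; map-tabulate; map-cong)
open import Data.Nat
open import Data.Nat.Combinatorics
  using (_C_; _P_; nCk≡nPk/k!; k>n⇒nCk≡0; k![n∸k]!∣n!; nCk+nC[k+1]≡[n+1]C[k+1]; nCn≡1)
open import Data.Nat.Combinatorics.Base using (_P′_)
open import Data.Nat.Combinatorics.Specification using (k!∣nP′k)
open import Data.Nat.Divisibility using (∣-trans; m∣m*n)
open import Data.Nat.DivMod using (_/_; m*[n/m]≡n)
open import Data.Nat.ListAction using (sum)
open import Data.Nat.ListAction.Properties using (sum-++)
open import Data.Nat.Properties
open import Data.Nat.Tactic.RingSolver using (solve-∀)
open import Data.Product using (_×_; _,_; proj₁; proj₂; ∃-syntax)
open import Data.Sum using (_⊎_; inj₁; inj₂)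
open import Data.Vec using ([]; _∷_; lookup; tabulate)
import Data.Vec.Properties as Vec
open import Function.Bundles using (Equivalence; _⇔_; mk⇔)
open import Relation.Binary.Definitions using (DecidableEquality; tri<; tri≈; tri>)
open import Relation.Binary.PropositionalEquality hiding ([_])
open import Relation.Nullary using (Dec; yes; no; does; ¬_)
open import Relation.Nullary.Decidable using (dec-true; dec-false; decidable-stable)

open import Defs

if-true : ∀ {A : Set} {b} {x y : A} → b ≡ true → (if b then x else y) ≡ x
if-true refl = refl

if-false : ∀ {A : Set} {b} {x y : A} → b ≡ false → (if b then x else y) ≡ y
if-false refl = refl

*-if : ∀ K b x → K * (if b then x else 0) ≡ (if b then K * x else 0)
*-if K true x = refl
*-if K false x = *-zeroʳ K

if-pos : ∀ b {x} → 1 ≤ (if b then x else 0) → b ≡ true × 1 ≤ x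
if-pos true x≥1 = refl , x≥1

if-dec-pos : ∀ {P : Set} (p? : Dec P) {x} → 1 ≤ (if does p? then x else 0) → P × 1 ≤ x
if-dec-pos (yes p) x≥1 = p , x≥1

≤⇒≤ᵇ≡true : ∀ {m n} → m ≤ n → (m ≤ᵇ n) ≡ true
≤⇒≤ᵇ≡true m≤n = Equivalence.to T-≡ (≤⇒≤ᵇ m≤n)

x*[y*z]≡y*[x*z] : ∀ x y z → x * (y * z) ≡ y * (x * z)
x*[y*z]≡y*[x*z] = solve-∀

+-≤-≡ : ∀ {x a y b} → x ≤ a → y ≤ b → x + y ≡ a + b → x ≡ a × y ≡ b
+-≤-≡ {x} {a} {y} {b} x≤a y≤b eq = x≡a , +-cancelˡ-≡ a y b (trans (cong (_+ y) (sym x≡a)) eq)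
  where
    x≡a : x ≡ a
    x≡a = ≤-antisym x≤a (+-cancelʳ-≤ b a x (subst (_≤ x + b) eq (+-monoʳ-≤ x y≤b)))

m+n+o∸p≤m : ∀ m {n o p} → n + o ≤ p → m + n + o ∸ p ≤ m
m+n+o∸p≤m m {n} {o} {p} n+o≤p = begin
  m + n + o ∸ p   ≡⟨ cong (_∸ p) (+-assoc m n o) ⟩
  m + (n + o) ∸ p ≤⟨ ∸-monoˡ-≤ p (+-monoʳ-≤ m n+o≤p) ⟩
  m + p ∸ p       ≡⟨ m+n∸n≡m m p ⟩
  m               ∎
  where open ≤-Reasoning

*-pos⁻¹ : ∀ m n → 1 ≤ m * n → 1 ≤ m × 1 ≤ n
*-pos⁻¹ (suc m) (suc n) _ = s≤s z≤n , s≤s z≤n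
*-pos⁻¹ (suc m) zero m*0≥1 with () ← subst (1 ≤_) (*-zeroʳ m) m*0≥1

*-≤-tight : ∀ {x q u v} → 1 ≤ x → 1 ≤ q → 1 ≤ u → u ≤ v → x * q * v ≤ q * u → x ≡ 1 × v ≤ u
*-≤-tight {x} {q} {u} {v} x≥1 q≥1 u≥1 u≤v xqv≤qu = ≤-antisym x≤1 x≥1 , v≤u
  where
    open ≤-Reasoning
    x≤1 : x ≤ 1
    x≤1 = *-cancelʳ-≤ x 1 (q * u) {{>-nonZero (*-mono-≤ q≥1 u≥1)}} (begin
      x * (q * u) ≤⟨ *-monoʳ-≤ x (*-monoʳ-≤ q u≤v) ⟩
      x * (q * v) ≡⟨ *-assoc x q v ⟨
      x * q * v   ≤⟨ xqv≤qu ⟩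
      q * u       ≡⟨ *-identityˡ (q * u) ⟨
      1 * (q * u) ∎)
    v≤u : v ≤ u
    v≤u = *-cancelˡ-≤ q {{>-nonZero q≥1}} (begin
      q * v       ≤⟨ m≤n*m (q * v) x {{>-nonZero x≥1}} ⟩
      x * (q * v) ≡⟨ *-assoc x q v ⟨
      x * q * v   ≤⟨ xqv≤qu ⟩
      q * u       ∎)

*-distribˡ-sum : ∀ {X : Set} c (f : X → ℕ) xs → c * sum (map f xs) ≡ sum (map (λ x → c * f x) xs)
*-distribˡ-sum c f [] = *-zeroʳ c
*-distribˡ-sum c f (x ∷ xs) = trans (*-distribˡ-+ c (f x) _) (cong (c * f x +_) (*-distribˡ-sum c f xs))

*-distribʳ-sum : ∀ {X : Set} c (f : X → ℕ) xs → sum (map f xs) * c ≡ sum (map (λ x → f x * c) xs)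
*-distribʳ-sum c f xs = trans (*-comm _ c) (trans (*-distribˡ-sum c f xs) (cong sum (map-cong (λ x → *-comm c (f x)) xs)))

sum-upTo-suc : ∀ m (f : ℕ → ℕ) → sum (map f (upTo (suc m))) ≡ sum (map f (upTo m)) + f m
sum-upTo-suc m f = begin
  sum (map f (upTo (suc m)))       ≡⟨ cong (λ l → sum (map f l)) (upTo-∷ʳ m) ⟨
  sum (map f (upTo m ++ [ m ]))    ≡⟨ cong sum (map-++ f (upTo m) [ m ]) ⟩
  sum (map f (upTo m) ++ [ f m ])  ≡⟨ sum-++ (map f (upTo m)) [ f m ] ⟩
  sum (map f (upTo m)) + (f m + 0) ≡⟨ cong (sum (map f (upTo m)) +_) (+-identityʳ (f m)) ⟩
  sum (map f (upTo m)) + f m       ∎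
  where open ≡-Reasoning

sum-upTo-0 : ∀ m (f : ℕ → ℕ) → (∀ i → i < m → f i ≡ 0) → sum (map f (upTo m)) ≡ 0
sum-upTo-0 zero f _ = refl
sum-upTo-0 (suc m) f f≗0 = trans (sum-upTo-suc m f)
  (cong₂ _+_ (sum-upTo-0 m f (λ i i<m → f≗0 i (m<n⇒m<1+n i<m))) (f≗0 m ≤-refl))

sum-upTo-point : ∀ m (f : ℕ → ℕ) {j} → j < m → (∀ i → i ≢ j → f i ≡ 0) → sum (map f (upTo m)) ≡ f j
sum-upTo-point (suc m) f {j} j<1+m f≗0 with m≤n⇒m<n∨m≡n (s≤s⁻¹ j<1+m)
... | inj₁ j<m = trans (sum-upTo-suc m f)
  (trans (cong₂ _+_ (sum-upTo-point m f j<m f≗0) (f≗0 m (λ m≡j → <-irrefl (sym m≡j) j<m))) (+-identityʳ (f j)))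
... | inj₂ refl = trans (sum-upTo-suc m f)
  (cong (_+ f m) (sum-upTo-0 m f (λ i i<m → f≗0 i (λ i≡m → <-irrefl i≡m i<m))))

foldr-⊔-attained : ∀ {A : Set} (f : A → ℕ) xs → 1 ≤ foldr (λ x r → f x ⊔ r) 0 xs
                 → ∃[ x ] f x ≡ foldr (λ x r → f x ⊔ r) 0 xs
foldr-⊔-attained f (x ∷ xs) max≥1 with ⊔-sel (f x) (foldr (λ x r → f x ⊔ r) 0 xs)
... | inj₁ max≡fx = x , sym max≡fx
... | inj₂ max≡rest with foldr-⊔-attained f xs (subst (1 ≤_) max≡rest max≥1)
... | y , fy≡ = y , trans fy≡ (sym max≡rest)

!*C≡P′ : ∀ N e → e ! * (N C e) ≡ N P′ e
!*C≡P′ N e with e ≤? N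
... | yes e≤N = begin
  e ! * (N C e)            ≡⟨ cong (e ! *_) (nCk≡nPk/k! e≤N) ⟩
  e ! * ((N P e) / e !)    ≡⟨ cong (λ z → e ! * (z / e !)) (if-true (≤⇒≤ᵇ≡true e≤N)) ⟩
  e ! * ((N P′ e) / e !)   ≡⟨ m*[n/m]≡n (k!∣nP′k e≤N) ⟩
  N P′ e                   ∎
  where
    open ≡-Reasoning
    instance _ = e !≢0
... | no e≰N with ≰⇒> e≰N
... | s≤s {n = j} N≤j = begin
  e ! * (N C e) ≡⟨ cong (e ! *_) (k>n⇒nCk≡0 (s≤s N≤j)) ⟩
  e ! * 0       ≡⟨ *-zeroʳ (e !) ⟩
  0             ≡⟨ cong (_* (N P′ j)) (m≤n⇒m∸n≡0 N≤j) ⟨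
  N P′ e        ∎
  where open ≡-Reasoning

P′≤^ : ∀ {N M} j → N ≤ M → N P′ j ≤ M ^ j
P′≤^ zero N≤M = ≤-refl
P′≤^ {N} (suc j) N≤M = *-mono-≤ (≤-trans (m∸n≤m N j) N≤M) (P′≤^ j N≤M)

∸^≤P′ : ∀ N j → (N ∸ j) ^ j ≤ N P′ j
∸^≤P′ N zero = ≤-refl
∸^≤P′ N (suc j) = *-mono-≤ (∸-monoʳ-≤ N (n≤1+n j))
  (≤-trans (^-monoˡ-≤ j (∸-monoʳ-≤ N (n≤1+n j))) (∸^≤P′ N j))

C-pos : ∀ {n r} → r ≤ n → 1 ≤ n C r
C-pos {r = zero} _ = ≤-refl
C-pos {suc n} {suc r} (s≤s r≤n) =
  subst (1 ≤_) (nCk+nC[k+1]≡[n+1]C[k+1] n r) (≤-trans (C-pos r≤n) (m≤m+n _ _))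

-- Pascal's rule makes n C r ≥ 2 strictly inside the range.
C≡1⇒ : ∀ {n r} → r ≤ n → n C r ≡ 1 → r ≡ 0 ⊎ r ≡ n
C≡1⇒ {r = zero} _ _ = inj₁ refl
C≡1⇒ {suc n} {suc r} (s≤s r≤n) nCr≡1 with m≤n⇒m<n∨m≡n r≤n
... | inj₂ r≡n = inj₂ (cong suc r≡n)
... | inj₁ r<n = ⊥-elim (<⇒≱ (s≤s (≤-refl {1}))
      (subst (2 ≤_) (trans (nCk+nC[k+1]≡[n+1]C[k+1] n r) nCr≡1) (+-mono-≤ (C-pos r≤n) (C-pos r<n))))

C-pos⁻¹ : ∀ {n r} → 1 ≤ n C r → r ≤ n
C-pos⁻¹ {n} {r} nCr≥1 = decidable-stable (r ≤? n) (λ r≰n → <⇒≱ nCr≥1 (≤-reflexive (k>n⇒nCk≡0 (≰⇒> r≰n))))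

C[k∸u,k∸x]≡1⇒ : ∀ {k u x} → u ≤ x → x ≤ k → (k ∸ u) C (k ∸ x) ≡ 1 → x ≡ u ⊎ x ≡ k
C[k∸u,k∸x]≡1⇒ {k} u≤x x≤k C≡1 with C≡1⇒ (∸-monoʳ-≤ k u≤x) C≡1
... | inj₁ k∸x≡0 = inj₂ (≤-antisym x≤k (m∸n≡0⇒m≤n k∸x≡0))
... | inj₂ k∸x≡k∸u = inj₁ (∸-cancelˡ-≡ x≤k (≤-trans u≤x x≤k) k∸x≡k∸u)

Cdiff-≤ : ∀ n {x y} → y ≤ x → Cdiff n x y ≡ n C (x ∸ y)
Cdiff-≤ n {x} {y} y≤x = if-true (dec-true (y ≤? x) y≤x)

Cdiff-≰ : ∀ n {x y} → ¬ y ≤ x → Cdiff n x y ≡ 0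
Cdiff-≰ n {x} {y} y≰x = if-false (dec-false (y ≤? x) y≰x)

-- Asymptotics in M

-- f M = A·M^δ + O(M^(δ∸1)), expressed by a lower bound beyond a threshold and an
-- upper bound multiplied by M.
record Asymptotic (f : ℕ → ℕ) (δ A : ℕ) : Set where
  constructor asymptotic
  field
    threshold slack : ℕ
    lower : ∀ M → threshold ≤ M → A * (M ∸ threshold) ^ δ ≤ f M
    upper : ∀ M → threshold ≤ M → M * f M ≤ A * M ^ suc δ + slack * M ^ δ

module _ where
  open ≤-Reasoning

  ∸-^-antitone : ∀ M {a b} δ → a ≤ b → (M ∸ b) ^ δ ≤ (M ∸ a) ^ δ
  ∸-^-antitone M δ a≤b = ^-monoˡ-≤ δ (∸-monoʳ-≤ M a≤b)

  Asymptotic-cong : ∀ {f g δ A} → (∀ M → f M ≡ g M) → Asymptotic f δ A → Asymptotic g δ A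
  Asymptotic-cong {δ = δ} {A} f≗g (asymptotic N₀ R lo up) = asymptotic N₀ R
    (λ M N₀≤M → subst (A * (M ∸ N₀) ^ δ ≤_) (f≗g M) (lo M N₀≤M))
    (λ M N₀≤M → subst (λ z → M * z ≤ A * M ^ suc δ + R * M ^ δ) (f≗g M) (up M N₀≤M))

  Asymptotic-0 : ∀ δ → Asymptotic (λ _ → 0) δ 0
  Asymptotic-0 δ = asymptotic 0 0 (λ _ _ → z≤n) (λ M _ → ≤-reflexive (*-zeroʳ M))

  Asymptotic-1 : Asymptotic (λ _ → 1) 0 1
  Asymptotic-1 = asymptotic 0 0 (λ _ _ → ≤-refl) (λ M _ → ≤-reflexive (M*1≡1*[M*1]+0*1 M))
    where
      M*1≡1*[M*1]+0*1 : ∀ M → M * 1 ≡ 1 * (M * 1) + 0 * 1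
      M*1≡1*[M*1]+0*1 = solve-∀

  Asymptotic-+ : ∀ {f g δ A B} → Asymptotic f δ A → Asymptotic g δ B
               → Asymptotic (λ M → f M + g M) δ (A + B)
  Asymptotic-+ {f} {g} {δ} {A} {B} (asymptotic N₁ R₁ lo₁ up₁) (asymptotic N₂ R₂ lo₂ up₂) =
    asymptotic (N₁ ⊔ N₂) (R₁ + R₂) lo up
    where
      N₁≤ = m≤m⊔n N₁ N₂
      N₂≤ = m≤n⊔m N₁ N₂
      lo : ∀ M → N₁ ⊔ N₂ ≤ M → (A + B) * (M ∸ (N₁ ⊔ N₂)) ^ δ ≤ f M + g M
      lo M N≤M = begin
        (A + B) * x                         ≡⟨ *-distribʳ-+ x A B ⟩
        A * x + B * x                       ≤⟨ +-mono-≤ (*-monoʳ-≤ A (∸-^-antitone M δ N₁≤))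
                                                        (*-monoʳ-≤ B (∸-^-antitone M δ N₂≤)) ⟩
        A * (M ∸ N₁) ^ δ + B * (M ∸ N₂) ^ δ ≤⟨ +-mono-≤ (lo₁ M (≤-trans N₁≤ N≤M)) (lo₂ M (≤-trans N₂≤ N≤M)) ⟩
        f M + g M                           ∎
        where x = (M ∸ (N₁ ⊔ N₂)) ^ δ
      regroup : ∀ a b r s p q → (a * p + r * q) + (b * p + s * q) ≡ (a + b) * p + (r + s) * q
      regroup = solve-∀
      up : ∀ M → N₁ ⊔ N₂ ≤ M → M * (f M + g M) ≤ (A + B) * M ^ suc δ + (R₁ + R₂) * M ^ δ
      up M N≤M = begin
        M * (f M + g M)       ≡⟨ *-distribˡ-+ M (f M) (g M) ⟩
        M * f M + M * g M     ≤⟨ +-mono-≤ (up₁ M (≤-trans N₁≤ N≤M)) (up₂ M (≤-trans N₂≤ N≤M)) ⟩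
        (A * M ^ suc δ + R₁ * M ^ δ) + (B * M ^ suc δ + R₂ * M ^ δ)
                              ≡⟨ regroup A B R₁ R₂ (M ^ suc δ) (M ^ δ) ⟩
        (A + B) * M ^ suc δ + (R₁ + R₂) * M ^ δ ∎

  Asymptotic-sum : ∀ {X : Set} {δ} (f : X → ℕ → ℕ) (A : X → ℕ) → (∀ x → Asymptotic (f x) δ (A x))
                 → ∀ xs → Asymptotic (λ M → sum (map (λ x → f x M) xs)) δ (sum (map A xs))
  Asymptotic-sum {δ = δ} f A fA [] = Asymptotic-0 δ
  Asymptotic-sum f A fA (x ∷ xs) = Asymptotic-+ (fA x) (Asymptotic-sum f A fA xs)

  Asymptotic-*ˡ : ∀ {f δ A} c → Asymptotic f δ A → Asymptotic (λ M → c * f M) δ (c * A)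
  Asymptotic-*ˡ {f} {δ} {A} c (asymptotic N₀ R lo up) = asymptotic N₀ (c * R)
    (λ M N₀≤M → begin
      c * A * (M ∸ N₀) ^ δ   ≡⟨ *-assoc c A _ ⟩
      c * (A * (M ∸ N₀) ^ δ) ≤⟨ *-monoʳ-≤ c (lo M N₀≤M) ⟩
      c * f M               ∎)
    (λ M N₀≤M → begin
      M * (c * f M)                   ≡⟨ x*[y*z]≡y*[x*z] M c (f M) ⟩
      c * (M * f M)                   ≤⟨ *-monoʳ-≤ c (up M N₀≤M) ⟩
      c * (A * M ^ suc δ + R * M ^ δ) ≡⟨ distrib c A R (M ^ suc δ) (M ^ δ) ⟩
      c * A * M ^ suc δ + c * R * M ^ δ ∎)
    where
      distrib : ∀ c a r p q → c * (a * p + r * q) ≡ c * a * p + c * r * q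
      distrib = solve-∀

  Asymptotic-*ˡ-pos : ∀ {f δ A} K → (1 ≤ K → Asymptotic f δ A) → Asymptotic (λ M → K * f M) δ (K * A)
  Asymptotic-*ˡ-pos {δ = δ} zero _ = Asymptotic-0 δ
  Asymptotic-*ˡ-pos (suc K) fA = Asymptotic-*ˡ (suc K) (fA (s≤s z≤n))

  Asymptotic-lower-order : ∀ {f δ A ε} → Asymptotic f δ A → δ < ε → Asymptotic f ε 0
  Asymptotic-lower-order {f} {δ} {A} {ε} (asymptotic N₀ R lo up) δ<ε =
    asymptotic (suc N₀) (A + R) (λ _ _ → z≤n) (λ M N₀<M → begin
      M * f M                   ≤⟨ up M (≤-trans (n≤1+n N₀) N₀<M) ⟩
      A * M ^ suc δ + R * M ^ δ ≤⟨ +-mono-≤ (*-monoʳ-≤ A (^-monoʳ-≤ M {{>-nonZero (M≥1 N₀<M)}} δ<ε))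
                                            (*-monoʳ-≤ R (^-monoʳ-≤ M {{>-nonZero (M≥1 N₀<M)}} (<⇒≤ δ<ε))) ⟩
      A * M ^ ε + R * M ^ ε     ≡⟨ *-distribʳ-+ (M ^ ε) A R ⟨
      (A + R) * M ^ ε           ∎)
    where
      M≥1 : ∀ {M} → suc N₀ ≤ M → 1 ≤ M
      M≥1 N₀<M = ≤-trans (s≤s z≤n) N₀<M

  Asymptotic-* : ∀ {f g δ ε A B} → Asymptotic f δ A → Asymptotic g ε B
               → Asymptotic (λ M → f M * g M) (δ + ε) (A * B)
  Asymptotic-* {f} {g} {δ} {ε} {A} {B} (asymptotic N₁ R₁ lo₁ up₁) (asymptotic N₂ R₂ lo₂ up₂) =
    asymptotic N₀ R lo up
    where
      N₀ = suc (N₁ ⊔ N₂)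
      R = A * R₂ + R₁ * B + R₁ * R₂
      N₁≤ = ≤-trans (m≤m⊔n N₁ N₂) (n≤1+n _)
      N₂≤ = ≤-trans (m≤n⊔m N₁ N₂) (n≤1+n _)
      interchange : ∀ a b p q → a * b * (p * q) ≡ (a * p) * (b * q)
      interchange = solve-∀
      lo : ∀ M → N₀ ≤ M → A * B * (M ∸ N₀) ^ (δ + ε) ≤ f M * g M
      lo M N₀≤M = begin
        A * B * x ^ (δ + ε)                    ≡⟨ cong (A * B *_) (^-distribˡ-+-* x δ ε) ⟩
        A * B * (x ^ δ * x ^ ε)                ≡⟨ interchange A B (x ^ δ) (x ^ ε) ⟩
        (A * x ^ δ) * (B * x ^ ε)              ≤⟨ *-mono-≤ (*-monoʳ-≤ A (∸-^-antitone M δ N₁≤))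
                                                           (*-monoʳ-≤ B (∸-^-antitone M ε N₂≤)) ⟩
        (A * (M ∸ N₁) ^ δ) * (B * (M ∸ N₂) ^ ε) ≤⟨ *-mono-≤ (lo₁ M (≤-trans N₁≤ N₀≤M)) (lo₂ M (≤-trans N₂≤ N₀≤M)) ⟩
        f M * g M                              ∎
        where x = M ∸ N₀
      expand : ∀ a b r s m p q → (a * (m * p) + r * p) * (b * (m * q) + s * q)
             ≡ m * (a * b * (m * (p * q)) + (a * s + r * b) * (p * q)) + r * s * (p * q)
      expand = solve-∀
      collect : ∀ a b r s m z → m * (a * b * (m * z) + (a * s + r * b) * z) + r * s * (z * m)
              ≡ m * (a * b * (m * z) + (a * s + r * b + r * s) * z)
      collect = solve-∀
      up : ∀ M → N₀ ≤ M → M * (f M * g M) ≤ A * B * M ^ suc (δ + ε) + R * M ^ (δ + ε)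
      up M N₀≤M = *-cancelˡ-≤ M {{M≢0}} (begin
        M * (M * (f M * g M))  ≡⟨ cong (M *_) (x*[y*z]≡y*[x*z] M (f M) (g M)) ⟩
        M * (f M * (M * g M))  ≡⟨ *-assoc M (f M) (M * g M) ⟨
        (M * f M) * (M * g M)  ≤⟨ *-mono-≤ (up₁ M (≤-trans N₁≤ N₀≤M)) (up₂ M (≤-trans N₂≤ N₀≤M)) ⟩
        (A * (M * Mᵟ) + R₁ * Mᵟ) * (B * (M * Mᵋ) + R₂ * Mᵋ)
                               ≡⟨ expand A B R₁ R₂ M Mᵟ Mᵋ ⟩
        M * (A * B * (M * (Mᵟ * Mᵋ)) + (A * R₂ + R₁ * B) * (Mᵟ * Mᵋ)) + R₁ * R₂ * (Mᵟ * Mᵋ)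
                               ≤⟨ +-monoʳ-≤ (M * _) (*-monoʳ-≤ (R₁ * R₂) (m≤m*n (Mᵟ * Mᵋ) M {{M≢0}})) ⟩
        M * (A * B * (M * (Mᵟ * Mᵋ)) + (A * R₂ + R₁ * B) * (Mᵟ * Mᵋ)) + R₁ * R₂ * ((Mᵟ * Mᵋ) * M)
                               ≡⟨ collect A B R₁ R₂ M (Mᵟ * Mᵋ) ⟩
        M * (A * B * (M * (Mᵟ * Mᵋ)) + R * (Mᵟ * Mᵋ))
                               ≡⟨ cong (λ z → M * (A * B * (M * z) + R * z)) (^-distribˡ-+-* M δ ε) ⟨
        M * (A * B * M ^ suc (δ + ε) + R * M ^ (δ + ε)) ∎)
        where
          M≢0 = >-nonZero (≤-trans (s≤s z≤n) N₀≤M)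
          Mᵟ = M ^ δ
          Mᵋ = M ^ ε

  Asymptotic-if : ∀ {f δ A} b → (b ≡ true → Asymptotic f δ A)
                → Asymptotic (λ M → if b then f M else 0) δ (if b then A else 0)
  Asymptotic-if true fA = fA refl
  Asymptotic-if {δ = δ} false _ = Asymptotic-0 δ

  Asymptotic-pad : ∀ {f e A} δ → Asymptotic f e A → e ≤ δ
                 → Asymptotic f δ (if does (e ≟ δ) then A else 0)
  Asymptotic-pad {f} {e} δ fA e≤δ with e ≟ δ
  ... | yes refl = subst (Asymptotic f e) (sym (if-true (dec-true (e ≟ e) refl))) fA
  ... | no e≢δ = subst (Asymptotic f δ) (sym (if-false (dec-false (e ≟ δ) e≢δ)))
                   (Asymptotic-lower-order fA (≤∧≢⇒< e≤δ e≢δ))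

  ^-suc-≤ : ∀ w M c → M ^ suc w ≤ M * (M ∸ c) ^ w + w * c * M ^ w
  ^-suc-≤ zero M c = m≤m+n (M * 1) 0
  ^-suc-≤ (suc w) M c = begin
    M * M ^ suc w                             ≤⟨ *-monoʳ-≤ M (^-suc-≤ w M c) ⟩
    M * (M * x ^ w + w * c * M ^ w)           ≡⟨ l₁ M (x ^ w) w c (M ^ w) ⟩
    M * M * x ^ w + w * c * (M * M ^ w)       ≤⟨ +-monoˡ-≤ (w * c * (M * M ^ w))
                                                   (*-monoˡ-≤ (x ^ w) (*-monoʳ-≤ M (m≤n+m∸n M c))) ⟩
    M * (c + x) * x ^ w + w * c * (M * M ^ w) ≡⟨ l₂ M c x (x ^ w) w (M * M ^ w) ⟩
    M * (x * x ^ w) + c * (M * x ^ w) + w * c * (M * M ^ w)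
                                              ≤⟨ +-monoˡ-≤ (w * c * (M * M ^ w)) (+-monoʳ-≤ (M * (x * x ^ w))
                                                   (*-monoʳ-≤ c (*-monoʳ-≤ M (^-monoˡ-≤ w (m∸n≤m M c))))) ⟩
    M * (x * x ^ w) + c * (M * M ^ w) + w * c * (M * M ^ w)
                                              ≡⟨ l₃ M (x * x ^ w) c w (M * M ^ w) ⟩
    M * (x * x ^ w) + suc w * c * (M * M ^ w) ∎
    where
      x = M ∸ c
      l₁ : ∀ m p w c q → m * (m * p + w * c * q) ≡ m * m * p + w * c * (m * q)
      l₁ = solve-∀
      l₂ : ∀ m c x p w q → m * (c + x) * p + w * c * q ≡ m * (x * p) + c * (m * p) + w * c * q
      l₂ = solve-∀
      l₃ : ∀ m a c w q → m * a + c * q + w * c * q ≡ m * a + (1 + w) * c * q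
      l₃ = solve-∀

  -- At M = E + T + N₁ + N₂ + 1 the bounds A·M^(w+1) + E·M^w ≥ M·f M = M·g M ≥ B·M^(w+1) − E·M^w
  -- (the latter via ^-suc-≤) leave no room for A < B.
  Asymptotic-unique-< : ∀ {f g w A B} T → (∀ M → T ≤ M → f M ≡ g M)
                      → Asymptotic f w A → Asymptotic g w B → ¬ A < B
  Asymptotic-unique-< {f} {g} {w} {A} {B} T f≡g (asymptotic N₁ R₁ lo₁ up₁) (asymptotic N₂ R₂ lo₂ up₂) A<B =
    <⇒≱ E<M M≤E
    where
      E = R₁ + B * w * N₂
      M = suc (E + T + N₁ + N₂)
      T≤M : T ≤ M
      T≤M = ≤-trans (≤-trans (m≤n+m T E) (≤-trans (m≤m+n (E + T) N₁) (m≤m+n _ N₂))) (n≤1+n _)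
      N₁≤M : N₁ ≤ M
      N₁≤M = ≤-trans (≤-trans (m≤n+m N₁ (E + T)) (m≤m+n _ N₂)) (n≤1+n _)
      N₂≤M : N₂ ≤ M
      N₂≤M = ≤-trans (m≤n+m N₂ (E + T + N₁)) (n≤1+n _)
      E<M : E < M
      E<M = s≤s (≤-trans (m≤m+n E T) (≤-trans (m≤m+n (E + T) N₁) (m≤m+n _ N₂)))
      Mʷ = M ^ w
      l₁ : ∀ b m y w c p → b * (m * y + w * c * p) ≡ m * (b * y) + b * w * c * p
      l₁ = solve-∀
      l₂ : ∀ a p₁ r p z → a * p₁ + r * p + z * p ≡ a * p₁ + (r + z) * p
      l₂ = solve-∀
      squeeze : A * M ^ suc w + M ^ suc w ≤ A * M ^ suc w + E * Mʷ
      squeeze = begin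
        A * M ^ suc w + M ^ suc w                 ≡⟨ +-comm (A * M ^ suc w) (M ^ suc w) ⟩
        suc A * M ^ suc w                         ≤⟨ *-monoˡ-≤ (M ^ suc w) A<B ⟩
        B * M ^ suc w                             ≤⟨ *-monoʳ-≤ B (^-suc-≤ w M N₂) ⟩
        B * (M * (M ∸ N₂) ^ w + w * N₂ * Mʷ)       ≡⟨ l₁ B M ((M ∸ N₂) ^ w) w N₂ Mʷ ⟩
        M * (B * (M ∸ N₂) ^ w) + B * w * N₂ * Mʷ   ≤⟨ +-monoˡ-≤ (B * w * N₂ * Mʷ) (*-monoʳ-≤ M (lo₂ M N₂≤M)) ⟩
        M * g M + B * w * N₂ * Mʷ                  ≡⟨ cong (λ z → M * z + B * w * N₂ * Mʷ) (f≡g M T≤M) ⟨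
        M * f M + B * w * N₂ * Mʷ                  ≤⟨ +-monoˡ-≤ (B * w * N₂ * Mʷ) (up₁ M N₁≤M) ⟩
        A * M ^ suc w + R₁ * Mʷ + B * w * N₂ * Mʷ   ≡⟨ l₂ A (M ^ suc w) R₁ Mʷ (B * w * N₂) ⟩
        A * M ^ suc w + E * Mʷ                     ∎
      M≤E : M ≤ E
      M≤E = *-cancelʳ-≤ M E Mʷ {{m^n≢0 M w}} (+-cancelˡ-≤ (A * M ^ suc w) _ _ squeeze)

  Asymptotic-unique : ∀ {f g w A B} T → (∀ M → T ≤ M → f M ≡ g M)
                    → Asymptotic f w A → Asymptotic g w B → A ≡ B
  Asymptotic-unique {A = A} {B} T f≡g fA gB with <-cmp A B
  ... | tri< A<B _ _ = ⊥-elim (Asymptotic-unique-< T f≡g fA gB A<B)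
  ... | tri≈ _ A≡B _ = A≡B
  ... | tri> _ _ B<A = ⊥-elim (Asymptotic-unique-< T (λ M T≤M → sym (f≡g M T≤M)) gB fA B<A)

-- Leading coefficients of the Johnson scheme intersection numbers

module _ (k : ℕ) where

  -- the leading coefficient of k!·C(M, e) as a polynomial in M
  lead-C : ℕ → ℕ
  lead-C e = (k ! / e !) {{e !≢0}}

  lead-C*! : ∀ {e} → e ≤ k → lead-C e * e ! ≡ k !
  lead-C*! {e} e≤k = trans (*-comm (lead-C e) (e !))
    (m*[n/m]≡n {{e !≢0}} (∣-trans (m∣m*n ((k ∸ e) !)) (k![n∸k]!∣n! e≤k)))

  lead-C-pos : ∀ {e} → e ≤ k → 1 ≤ lead-C e
  lead-C-pos {e} e≤k with lead-C e | lead-C*! e≤k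
  ... | zero | 0≡k! = ⊥-elim (≢-nonZero⁻¹ (k !) {{k !≢0}} (sym 0≡k!))
  ... | suc _ | _ = s≤s z≤n

  C-asymptotic : ∀ {a e} → a ≤ k → e ≤ k → Asymptotic (λ M → k ! * ((M ∸ k ∸ a) C e)) e (lead-C e)
  C-asymptotic {a} {e} a≤k e≤k = asymptotic (k + k + k) 0
    (λ M _ → begin
      lead-C e * (M ∸ (k + k + k)) ^ e ≤⟨ *-monoʳ-≤ (lead-C e) (^-monoˡ-≤ e (shift M)) ⟩
      lead-C e * (N M ∸ e) ^ e          ≤⟨ *-monoʳ-≤ (lead-C e) (∸^≤P′ (N M) e) ⟩
      lead-C e * (N M P′ e)             ≡⟨ k!*C≡lead*P′ M ⟨
      k ! * (N M C e)                   ∎)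
    (λ M _ → begin
      M * (k ! * (N M C e))             ≡⟨ cong (M *_) (k!*C≡lead*P′ M) ⟩
      M * (lead-C e * (N M P′ e))       ≤⟨ *-monoʳ-≤ M (*-monoʳ-≤ (lead-C e) (P′≤^ e (N≤M M))) ⟩
      M * (lead-C e * M ^ e)            ≡⟨ regroup M (lead-C e) (M ^ e) ⟩
      lead-C e * M ^ suc e + 0 * M ^ e  ∎)
    where
      open ≤-Reasoning
      N : ℕ → ℕ
      N M = M ∸ k ∸ a
      N≤M : ∀ M → N M ≤ M
      N≤M M = ≤-trans (m∸n≤m (M ∸ k) a) (m∸n≤m M k)
      shift : ∀ M → M ∸ (k + k + k) ≤ N M ∸ e
      shift M = begin
        M ∸ (k + k + k) ≤⟨ ∸-monoʳ-≤ M (+-mono-≤ (+-monoʳ-≤ k a≤k) e≤k) ⟩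
        M ∸ (k + a + e) ≡⟨ ∸-+-assoc M (k + a) e ⟨
        M ∸ (k + a) ∸ e ≡⟨ cong (_∸ e) (∸-+-assoc M k a) ⟨
        N M ∸ e         ∎
      k!*C≡lead*P′ : ∀ M → k ! * (N M C e) ≡ lead-C e * (N M P′ e)
      k!*C≡lead*P′ M = begin-equality
        k ! * (N M C e)              ≡⟨ cong (_* (N M C e)) (lead-C*! e≤k) ⟨
        lead-C e * e ! * (N M C e)   ≡⟨ *-assoc (lead-C e) (e !) _ ⟩
        lead-C e * (e ! * (N M C e)) ≡⟨ cong (lead-C e *_) (!*C≡P′ (N M) e) ⟩
        lead-C e * (N M P′ e)        ∎
      regroup : ∀ m q p → m * (q * p) ≡ q * (m * p) + 0 * p
      regroup = solve-∀

  -- the coefficient of M^δ in k!·Cdiff (M ∸ k ∸ a) s k = k!·C(M ∸ k ∸ a, s ∸ k)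
  Cdiff-lead : ℕ → ℕ → ℕ
  Cdiff-lead s δ = if k ≤ᵇ s then (if does (s ∸ k ≟ δ) then lead-C (s ∸ k) else 0) else 0

  Cdiff-asymptotic : ∀ {a s δ} → a ≤ k → s ∸ k ≤ δ → s ∸ k ≤ k
                   → Asymptotic (λ M → k ! * Cdiff (M ∸ k ∸ a) s k) δ (Cdiff-lead s δ)
  Cdiff-asymptotic {a} {s} {δ} a≤k e≤δ e≤k with k ≤? s
  ... | yes k≤s = subst (Asymptotic _ δ) (sym (if-true (dec-true (k ≤? s) k≤s)))
      (Asymptotic-cong (λ M → cong (k ! *_) (sym (Cdiff-≤ (M ∸ k ∸ a) k≤s)))
        (Asymptotic-pad δ (C-asymptotic a≤k e≤k) e≤δ))
  ... | no k≰s = subst (Asymptotic _ δ) (sym (if-false (dec-false (k ≤? s) k≰s)))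
      (Asymptotic-cong (λ M → sym (trans (cong (k ! *_) (Cdiff-≰ (M ∸ k ∸ a) k≰s)) (*-zeroʳ (k !))))
        (Asymptotic-0 δ))

  Cdiff-lead-≢ : ∀ {s δ} → s ≢ k + δ → Cdiff-lead s δ ≡ 0
  Cdiff-lead-≢ {s} {δ} s≢k+δ with k ≤? s
  ... | no k≰s = if-false (dec-false (k ≤? s) k≰s)
  ... | yes k≤s = trans (if-true (dec-true (k ≤? s) k≤s)) (if-false (dec-false (s ∸ k ≟ δ) e≢δ))
    where
      e≢δ : s ∸ k ≢ δ
      e≢δ e≡δ = s≢k+δ (trans (sym (m+[n∸m]≡n k≤s)) (cong (k +_) e≡δ))

  Cdiff-lead-≡ : ∀ δ → Cdiff-lead (k + δ) δ ≡ lead-C δ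
  Cdiff-lead-≡ δ = begin
    Cdiff-lead (k + δ) δ  ≡⟨ if-true (dec-true (k ≤? k + δ) (m≤m+n k δ)) ⟩
    (if does (k + δ ∸ k ≟ δ) then lead-C (k + δ ∸ k) else 0) ≡⟨ if-true (dec-true (k + δ ∸ k ≟ δ) e≡δ) ⟩
    lead-C (k + δ ∸ k)    ≡⟨ cong lead-C e≡δ ⟩
    lead-C δ              ∎
    where
      open ≡-Reasoning
      e≡δ = m+n∸m≡n k δ

  -- pJ k M a b c = Σᵢ pJ-weight a b c i * Cdiff (M ∸ k ∸ a) (b + c + i) k
  pJ-weight : ℕ → ℕ → ℕ → ℕ → ℕ
  pJ-weight a b c i = ((k ∸ a) C i) * Cdiff a k (b + i) * Cdiff a k (c + i)

  pJ-lead : ℕ → ℕ → ℕ → ℕ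
  pJ-lead a b c = sum (map (λ i → pJ-weight a b c i * Cdiff-lead (b + c + i) (b ⊓ c)) (upTo (suc k)))

  pJ-weight-pos : ∀ a b c i → 1 ≤ pJ-weight a b c i → b + i ≤ k × c + i ≤ k
  pJ-weight-pos a b c i w≥1 =
      decidable-stable (b + i ≤? k) (λ bi≰k → <⇒≱ w≥1 (≤-reflexive (trans
        (cong (λ z → ((k ∸ a) C i) * z * Cdiff a k (c + i)) (Cdiff-≰ a bi≰k))
        (cong (_* Cdiff a k (c + i)) (*-zeroʳ ((k ∸ a) C i))))))
    , decidable-stable (c + i ≤? k) (λ ci≰k → <⇒≱ w≥1 (≤-reflexive (trans
        (cong (((k ∸ a) C i) * Cdiff a k (b + i) *_) (Cdiff-≰ a ci≰k))
        (*-zeroʳ (((k ∸ a) C i) * Cdiff a k (b + i))))))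

  pJ-asymptotic : ∀ {a b c} → a ≤ k → b ≤ k → c ≤ k
                → Asymptotic (λ M → k ! * pJ k M a b c) (b ⊓ c) (pJ-lead a b c)
  pJ-asymptotic {a} {b} {c} a≤k b≤k c≤k =
    Asymptotic-cong (λ M → sym (*-distribˡ-sum (k !) _ (upTo (suc k))))
      (Asymptotic-sum _ _ term (upTo (suc k)))
    where
      term : ∀ i → Asymptotic (λ M → k ! * (pJ-weight a b c i * Cdiff (M ∸ k ∸ a) (b + c + i) k))
                              (b ⊓ c) (pJ-weight a b c i * Cdiff-lead (b + c + i) (b ⊓ c))
      term i = Asymptotic-cong (λ M → x*[y*z]≡y*[x*z] (pJ-weight a b c i) (k !) _)
        (Asymptotic-*ˡ-pos (pJ-weight a b c i) λ w≥1 →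
          let (b+i≤k , c+i≤k) = pJ-weight-pos a b c i w≥1
              e≤b = m+n+o∸p≤m b c+i≤k
              e≤c = subst (λ s → s ∸ k ≤ c) (cong (_+ i) (+-comm c b)) (m+n+o∸p≤m c b+i≤k)
          in Cdiff-asymptotic a≤k (⊓-glb e≤b e≤c) (≤-trans e≤b b≤k))

  -- only the summand i = k ∸ v has degree v in M
  pJ-lead-diag : ∀ u {v} → v ≤ k → pJ-lead u v v ≡ ((k ∸ u) C (k ∸ v)) * lead-C v
  pJ-lead-diag u {v} v≤k = begin
    pJ-lead u v v    ≡⟨ cong (λ δ → sum (map (λ i → pJ-weight u v v i * Cdiff-lead (v + v + i) δ) (upTo (suc k)))) (⊓-idem v) ⟩
    sum (map (λ i → pJ-weight u v v i * Cdiff-lead (v + v + i) v) (upTo (suc k)))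
                     ≡⟨ sum-upTo-point (suc k) _ (s≤s (m∸n≤m k v)) off-diagonal ⟩
    pJ-weight u v v (k ∸ v) * Cdiff-lead (v + v + (k ∸ v)) v
                     ≡⟨ cong₂ (λ x s → X * x * x * Cdiff-lead s v) Cdiff-k (+-assoc v v (k ∸ v)) ⟩
    X * 1 * 1 * Cdiff-lead (v + (v + (k ∸ v))) v
                     ≡⟨ cong₂ (λ x s → x * Cdiff-lead s v) (trans (*-identityʳ (X * 1)) (*-identityʳ X))
                                                          (trans (cong (v +_) v+[k∸v]≡k) (+-comm v k)) ⟩
    X * Cdiff-lead (k + v) v ≡⟨ cong (X *_) (Cdiff-lead-≡ v) ⟩
    X * lead-C v     ∎
    where
      open ≡-Reasoning
      X = (k ∸ u) C (k ∸ v)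
      v+[k∸v]≡k = m+[n∸m]≡n v≤k
      Cdiff-k : Cdiff u k (v + (k ∸ v)) ≡ 1
      Cdiff-k = trans (Cdiff-≤ u {k} (≤-reflexive v+[k∸v]≡k)) (cong (u C_) (trans (cong (k ∸_) v+[k∸v]≡k) (n∸n≡0 k)))
      off-diagonal : ∀ i → i ≢ k ∸ v → pJ-weight u v v i * Cdiff-lead (v + v + i) v ≡ 0
      off-diagonal i i≢k∸v = trans (cong (pJ-weight u v v i *_) (Cdiff-lead-≢ s≢k+v)) (*-zeroʳ (pJ-weight u v v i))
        where
          s≢k+v : v + v + i ≢ k + v
          s≢k+v s≡k+v = i≢k∸v (trans (sym (m+n∸m≡n v i)) (cong (_∸ v) (+-cancelˡ-≡ v (v + i) k
            (trans (sym (+-assoc v v i)) (trans s≡k+v (+-comm k v))))))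

-- Counting occurrences in a list

module Counting {A : Set} (_≟_ : DecidableEquality A) where

  match : A → A → ℕ
  match x a = if does (x ≟ a) then 1 else 0

  count : A → List A → ℕ
  count a xs = sum (map (λ x → match x a) xs)

  count-++ : ∀ a xs ys → count a (xs ++ ys) ≡ count a xs + count a ys
  count-++ a xs ys = trans (cong sum (map-++ (λ x → match x a) xs ys)) (sum-++ (map (λ x → match x a) xs) _)

  _∖[_] : (A → ℕ) → A → A → ℕ
  (f ∖[ a ]) x = if does (x ≟ a) then 0 else f x

  sum-map-split : ∀ (f : A → ℕ) a xs → sum (map f xs) ≡ count a xs * f a + sum (map (f ∖[ a ]) xs)
  sum-map-split f a [] = refl
  sum-map-split f a (x ∷ xs) with x ≟ a
  ... | yes refl = begin
    f x + sum (map f xs)                              ≡⟨ cong (f x +_) (sum-map-split f x xs) ⟩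
    f x + (count x xs * f x + sum (map (f ∖[ x ]) xs)) ≡⟨ +-assoc (f x) _ _ ⟨
    suc (count x xs) * f x + sum (map (f ∖[ x ]) xs)  ∎
    where open ≡-Reasoning
  ... | no _ = trans (cong (f x +_) (sum-map-split f a xs))
                     (x+[y+z]≡y+[x+z] (f x) (count a xs * f a) (sum (map (f ∖[ a ]) xs)))
    where
      x+[y+z]≡y+[x+z] : ∀ x y z → x + (y + z) ≡ y + (x + z)
      x+[y+z]≡y+[x+z] = solve-∀

  sum-map-0 : ∀ (f : A → ℕ) xs → (∀ x → f x ≡ 0) → sum (map f xs) ≡ 0
  sum-map-0 f [] _ = refl
  sum-map-0 f (x ∷ xs) f≗0 = cong₂ _+_ (f≗0 x) (sum-map-0 f xs f≗0)

  sum-map-pos : ∀ (f : A → ℕ) xs → 1 ≤ sum (map f xs) → ∃[ x ] 1 ≤ f x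
  sum-map-pos f (x ∷ xs) Σ≥1 with f x in fx≡
  ... | suc _ = x , subst (1 ≤_) (sym fx≡) (s≤s z≤n)
  ... | zero = sum-map-pos f xs Σ≥1

  ≤-sum-map : ∀ (f : A → ℕ) {a} xs → 1 ≤ count a xs → f a ≤ sum (map f xs)
  ≤-sum-map f {a} xs a∈xs = begin
    f a                                        ≤⟨ m≤n*m (f a) (count a xs) {{>-nonZero a∈xs}} ⟩
    count a xs * f a                           ≤⟨ m≤m+n _ _ ⟩
    count a xs * f a + sum (map (f ∖[ a ]) xs) ≡⟨ sum-map-split f a xs ⟨
    sum (map f xs)                             ∎
    where open ≤-Reasoning

  +-≤-sum-map : ∀ (f : A → ℕ) {a b} xs → 1 ≤ count a xs → 1 ≤ count b xs → b ≢ a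
              → f a + f b ≤ sum (map f xs)
  +-≤-sum-map f {a} {b} xs a∈xs b∈xs b≢a = begin
    f a + f b                                  ≡⟨ cong (f a +_) (if-false (dec-false (b ≟ a) b≢a)) ⟨
    f a + (f ∖[ a ]) b                         ≤⟨ +-mono-≤ (m≤n*m (f a) (count a xs) {{>-nonZero a∈xs}}) (≤-sum-map (f ∖[ a ]) xs b∈xs) ⟩
    count a xs * f a + sum (map (f ∖[ a ]) xs) ≡⟨ sum-map-split f a xs ⟨
    sum (map f xs)                             ∎
    where open ≤-Reasoning

  sum-map-point : ∀ (f : A → ℕ) {a} xs → count a xs ≡ 1 → (∀ x → x ≢ a → f x ≡ 0) → sum (map f xs) ≡ f a
  sum-map-point f {a} xs once f≗0 = begin
    sum (map f xs)                             ≡⟨ sum-map-split f a xs ⟩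
    count a xs * f a + sum (map (f ∖[ a ]) xs) ≡⟨ cong₂ _+_ (cong (_* f a) once) (sum-map-0 (f ∖[ a ]) xs vanish) ⟩
    1 * f a + 0                                ≡⟨ trans (+-identityʳ _) (*-identityˡ (f a)) ⟩
    f a                                        ∎
    where
      open ≡-Reasoning
      vanish : ∀ x → (f ∖[ a ]) x ≡ 0
      vanish x with x ≟ a
      ... | yes _ = refl
      ... | no x≢a = f≗0 x x≢a

  ≤-foldr-⊔ : ∀ (f : A → ℕ) {a} xs → 1 ≤ count a xs → f a ≤ foldr (λ x r → f x ⊔ r) 0 xs
  ≤-foldr-⊔ f {a} (x ∷ xs) a∈x∷xs with x ≟ a
  ... | yes refl = m≤m⊔n (f x) _
  ... | no _ = ≤-trans (≤-foldr-⊔ f xs a∈x∷xs) (m≤n⊔m (f x) _)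


_≟ₚ_ : ∀ {k d} → DecidableEquality (Pt k d)
_≟ₚ_ = Vec.≡-dec Fin._≟_

module FinCounting {n : ℕ} = Counting (Fin._≟_ {n})
module PtCounting {k d : ℕ} = Counting (_≟ₚ_ {k} {d})

count-allFin : ∀ n (i : Fin n) → FinCounting.count i (allFinL n) ≡ 1
count-allFin (suc n) i = trans (cong (λ l → count i (fzero ∷ l)) (sym (map-tabulate (λ j → j) fsuc))) (at i)
  where
    open FinCounting
    count-fzero : ∀ l → count fzero (map fsuc l) ≡ 0
    count-fzero [] = refl
    count-fzero (_ ∷ l) = count-fzero l
    count-fsuc : ∀ (j : Fin n) l → count (fsuc j) (map fsuc l) ≡ count j l
    count-fsuc j [] = refl
    count-fsuc j (x ∷ l) = cong (match x j +_) (count-fsuc j l)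
    at : ∀ i → count i (fzero ∷ map fsuc (allFinL n)) ≡ 1
    at fzero = cong suc (count-fzero (allFinL n))
    at (fsuc j) = trans (count-fsuc j (allFinL n)) (count-allFin n j)

∧-indicator : ∀ b₁ b₂ → (if b₁ ∧ b₂ then 1 else 0) ≡ (if b₁ then 1 else 0) * (if b₂ then 1 else 0)
∧-indicator false _ = refl
∧-indicator true false = refl
∧-indicator true true = refl

count-allPts : ∀ k d (a : Pt k d) → PtCounting.count a (allPts k d) ≡ 1
count-allPts k zero [] = refl
count-allPts k (suc d) (h ∷ t) = begin
  count (h ∷ t) (allPts k (suc d))
    ≡⟨ count-concatMap (allFinL (suc k)) ⟩
  sum (map (λ x → count (h ∷ t) (map (x ∷_) (allPts k d))) (allFinL (suc k)))
    ≡⟨ cong sum (map-cong (λ x → count-map-∷ x (allPts k d)) (allFinL (suc k))) ⟩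
  sum (map (λ x → FinCounting.match x h * count t (allPts k d)) (allFinL (suc k)))
    ≡⟨ *-distribʳ-sum (count t (allPts k d)) (λ x → FinCounting.match x h) (allFinL (suc k)) ⟨
  FinCounting.count h (allFinL (suc k)) * count t (allPts k d)
    ≡⟨ cong₂ _*_ (count-allFin (suc k) h) (count-allPts k d t) ⟩
  1 ∎
  where
    open ≡-Reasoning
    open PtCounting
    count-concatMap : ∀ xs → count (h ∷ t) (concatMap (λ x → map (x ∷_) (allPts k d)) xs)
                    ≡ sum (map (λ x → count (h ∷ t) (map (x ∷_) (allPts k d))) xs)
    count-concatMap [] = refl
    count-concatMap (x ∷ xs) = trans (count-++ (h ∷ t) (map (x ∷_) (allPts k d)) _) (cong (_ +_) (count-concatMap xs))
    count-map-∷ : ∀ x ys → count (h ∷ t) (map (x ∷_) ys) ≡ FinCounting.match x h * count t ys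
    count-map-∷ x [] = sym (*-zeroʳ (FinCounting.match x h))
    count-map-∷ x (y ∷ ys) = begin
      match (x ∷ y) (h ∷ t) + count (h ∷ t) (map (x ∷_) ys)
        ≡⟨ cong₂ _+_ (∧-indicator (does (x Fin.≟ h)) (does (y ≟ₚ t))) (count-map-∷ x ys) ⟩
      FinCounting.match x h * match y t + FinCounting.match x h * count t ys
        ≡⟨ *-distribˡ-+ (FinCounting.match x h) _ _ ⟨
      FinCounting.match x h * (match y t + count t ys) ∎

module _ {k : ℕ} where

  ≤v-refl : ∀ {d} (a : Pt k d) → a ≤v a
  ≤v-refl _ _ = ≤-refl

  ≤v-∷ : ∀ {d u v} {y a : Pt k d} → toℕ u ≤ toℕ v → y ≤v a → (u ∷ y) ≤v (v ∷ a)
  ≤v-∷ u≤v _ fzero = u≤v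
  ≤v-∷ _ y≤a (fsuc i) = y≤a i

  ≤v-head : ∀ {d u v} {y a : Pt k d} → (u ∷ y) ≤v (v ∷ a) → toℕ u ≤ toℕ v
  ≤v-head u∷y≤v∷a = u∷y≤v∷a fzero

  ≤v-tail : ∀ {d u v} {y a : Pt k d} → (u ∷ y) ≤v (v ∷ a) → y ≤v a
  ≤v-tail u∷y≤v∷a i = u∷y≤v∷a (fsuc i)

  zeros-≤v : ∀ {d} (a : Pt k d) → zeros ≤v a
  zeros-≤v a i = subst (λ z → toℕ z ≤ toℕ (lookup a i)) (sym (Vec.lookup-replicate i fzero)) z≤n

  wt-mono : ∀ {d} (a b : Pt k d) → a ≤v b → wt a ≤ wt b
  wt-mono [] [] _ = z≤n
  wt-mono (_ ∷ a) (_ ∷ b) a≤b = +-mono-≤ (≤v-head a≤b) (wt-mono a b (≤v-tail a≤b))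

  ≤v∧wt≡⇒≡ : ∀ {d} (a b : Pt k d) → a ≤v b → wt a ≡ wt b → a ≡ b
  ≤v∧wt≡⇒≡ [] [] _ _ = refl
  ≤v∧wt≡⇒≡ (_ ∷ a) (_ ∷ b) a≤b wt≡ =
    let (head≡ , tail≡) = +-≤-≡ (≤v-head a≤b) (wt-mono a b (≤v-tail a≤b)) wt≡
    in cong₂ _∷_ (Fin.toℕ-injective head≡) (≤v∧wt≡⇒≡ a b (≤v-tail a≤b) tail≡)

  wt⊓ : ∀ {d} → Pt k d → Pt k d → ℕ
  wt⊓ [] [] = 0
  wt⊓ (v ∷ b) (w ∷ c) = toℕ v ⊓ toℕ w + wt⊓ b c

  wt⊓≤wtˡ : ∀ {d} (b c : Pt k d) → wt⊓ b c ≤ wt b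
  wt⊓≤wtˡ [] [] = z≤n
  wt⊓≤wtˡ (v ∷ b) (w ∷ c) = +-mono-≤ (m⊓n≤m (toℕ v) (toℕ w)) (wt⊓≤wtˡ b c)

  wt⊓≤wtʳ : ∀ {d} (b c : Pt k d) → wt⊓ b c ≤ wt c
  wt⊓≤wtʳ [] [] = z≤n
  wt⊓≤wtʳ (v ∷ b) (w ∷ c) = +-mono-≤ (m⊓n≤n (toℕ v) (toℕ w)) (wt⊓≤wtʳ b c)

  wt⊓≡wtˡ⇒≤v : ∀ {d} (b c : Pt k d) → wt⊓ b c ≡ wt b → b ≤v c
  wt⊓≡wtˡ⇒≤v (v ∷ b) (w ∷ c) wt≡ =
    let (head≡ , tail≡) = +-≤-≡ (m⊓n≤m (toℕ v) (toℕ w)) (wt⊓≤wtˡ b c) wt≡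
    in ≤v-∷ (m⊓n≡m⇒m≤n head≡) (wt⊓≡wtˡ⇒≤v b c tail≡)

  wt⊓-idem : ∀ {d} (b : Pt k d) → wt⊓ b b ≡ wt b
  wt⊓-idem [] = refl
  wt⊓-idem (v ∷ b) = cong₂ _+_ (⊓-idem (toℕ v)) (wt⊓-idem b)

  toℕ≤k : (u : Fin (suc k)) → toℕ u ≤ k
  toℕ≤k = Fin.toℕ≤pred[n]

  wt≤wtS : ∀ {d} (S : Subset k d) {b} → b ∈S S → wt b ≤ wtS S
  wt≤wtS {d} S {b} b∈S = subst (_≤ wtS S) (if-true b∈S)
    (≤-foldr-⊔ (λ x → if S x then wt x else 0) (allPts k d) (≤-reflexive (sym (count-allPts k d b))))
    where open PtCounting

  wtS-attained : ∀ {d} (S : Subset k d) {b} → b ∈S S → ∃[ a ] a ∈* S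
  wtS-attained {d} S {b} b∈S with wtS S in wtS≡
  ... | zero = b , b∈S , n≤0⇒n≡0 (subst (wt b ≤_) wtS≡ (wt≤wtS S b∈S))
  ... | suc w with foldr-⊔-attained (λ x → if S x then wt x else 0) (allPts k d) (subst (1 ≤_) (sym wtS≡) (s≤s z≤n))
  ...   | a , a≡max with S a in a∈S
  ...     | true = a , a∈S , trans a≡max wtS≡
  ...     | false with () ← trans a≡max wtS≡

  wt≡0⊎InSupp : ∀ {d} (a : Pt k d) → wt a ≡ 0 ⊎ ∃[ t ] InSupp a t
  wt≡0⊎InSupp [] = inj₁ refl
  wt≡0⊎InSupp (fzero ∷ a) with wt≡0⊎InSupp a
  ... | inj₁ wt≡0 = inj₁ wt≡0
  ... | inj₂ (t , t∈supp) = inj₂ (fsuc t , t∈supp)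
  wt≡0⊎InSupp (fsuc _ ∷ a) = inj₂ (fzero , s≤s z≤n)

  wt≡entry⊎InSupp : ∀ {d} (a : Pt k d) t → wt a ≡ toℕ (lookup a t) ⊎ ∃[ s ] (s ≢ t × InSupp a s)
  wt≡entry⊎InSupp (x ∷ a) fzero with wt≡0⊎InSupp a
  ... | inj₁ wt≡0 = inj₁ (trans (cong (toℕ x +_) wt≡0) (+-identityʳ (toℕ x)))
  ... | inj₂ (s , s∈supp) = inj₂ (fsuc s , (λ ()) , s∈supp)
  wt≡entry⊎InSupp (fzero ∷ a) (fsuc t) with wt≡entry⊎InSupp a t
  ... | inj₁ wt≡ = inj₁ wt≡
  ... | inj₂ (s , s≢t , s∈supp) = inj₂ (fsuc s , (λ s≡t → s≢t (Fin.suc-injective s≡t)) , s∈supp)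
  wt≡entry⊎InSupp (fsuc _ ∷ a) (fsuc t) = inj₂ (fzero , (λ ()) , s≤s z≤n)

  wt≡0⇒suppSize≡0 : ∀ {d} (a : Pt k d) → wt a ≡ 0 → suppSize a ≡ 0
  wt≡0⇒suppSize≡0 [] _ = refl
  wt≡0⇒suppSize≡0 (fzero ∷ a) wt≡0 = wt≡0⇒suppSize≡0 a wt≡0

  wt≡1⇒suppSize≡1 : ∀ {d} (a : Pt k d) → wt a ≡ 1 → suppSize a ≡ 1
  wt≡1⇒suppSize≡1 (fzero ∷ a) wt≡1 = wt≡1⇒suppSize≡1 a wt≡1
  wt≡1⇒suppSize≡1 (fsuc x ∷ a) wt≡1 = cong suc (wt≡0⇒suppSize≡0 a (m+n≡0⇒n≡0 (toℕ x) (suc-injective wt≡1)))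

  0-or-k⇒wt≡k*suppSize : ∀ {d} (a : Pt k d) → (∀ t → toℕ (lookup a t) ≡ 0 ⊎ toℕ (lookup a t) ≡ k)
                       → wt a ≡ k * suppSize a
  0-or-k⇒wt≡k*suppSize [] _ = sym (*-zeroʳ k)
  0-or-k⇒wt≡k*suppSize (fzero ∷ a) entries = 0-or-k⇒wt≡k*suppSize a (λ t → entries (fsuc t))
  0-or-k⇒wt≡k*suppSize (fsuc x ∷ a) entries with entries fzero
  ... | inj₂ x+1≡k = trans (cong₂ _+_ x+1≡k (0-or-k⇒wt≡k*suppSize a (λ t → entries (fsuc t)))) (sym (*-suc k (suppSize a)))

module _ {k : ℕ} (k≥1 : 1 ≤ k) where

  unit : ∀ {d} → Fin d → Pt k d
  unit t = tabulate (λ s → if does (s Fin.≟ t) then fromℕ< (s≤s k≥1) else fzero)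

  unit-at : ∀ {d} (t : Fin d) → toℕ (lookup (unit t) t) ≡ 1
  unit-at t = begin
    toℕ (lookup (unit t) t)   ≡⟨ cong toℕ (Vec.lookup∘tabulate _ t) ⟩
    toℕ (if does (t Fin.≟ t) then fromℕ< (s≤s k≥1) else fzero) ≡⟨ cong toℕ (if-true (dec-true (t Fin.≟ t) refl)) ⟩
    toℕ (fromℕ< (s≤s k≥1))   ≡⟨ Fin.toℕ-fromℕ< (s≤s k≥1) ⟩
    1                         ∎
    where open ≡-Reasoning

  unit-off : ∀ {d} {s t : Fin d} → s ≢ t → toℕ (lookup (unit t) s) ≡ 0
  unit-off {s = s} {t} s≢t = trans (cong toℕ (Vec.lookup∘tabulate _ s)) (cong toℕ (if-false (dec-false (s Fin.≟ t) s≢t)))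

  unit-≤v : ∀ {d} (a : Pt k d) {t} → InSupp a t → unit t ≤v a
  unit-≤v a {t} t∈supp s with s Fin.≟ t
  ... | yes refl = subst (_≤ toℕ (lookup a t)) (sym (unit-at t)) t∈supp
  ... | no s≢t = subst (_≤ toℕ (lookup a s)) (sym (unit-off s≢t)) z≤n

  unit≢zeros : ∀ {d} (t : Fin d) → unit t ≢ zeros
  unit≢zeros t unit≡zeros = 0≢1+n (trans (sym (cong toℕ (trans (cong (λ v → lookup v t) unit≡zeros)
                                                                 (Vec.lookup-replicate t fzero))))
                                         (unit-at t))

-- The leading coefficient of p^y_{α,α}

module _ {k : ℕ} where

  pV-lead : ∀ {d} → Pt k d → Pt k d → Pt k d → ℕ
  pV-lead [] [] [] = 1
  pV-lead (u ∷ y) (v ∷ b) (w ∷ c) = pJ-lead k (toℕ u) (toℕ v) (toℕ w) * pV-lead y b c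

  pV-asymptotic : ∀ {d} (y b c : Pt k d) → Asymptotic (λ M → (k !) ^ d * pV M y b c) (wt⊓ b c) (pV-lead y b c)
  pV-asymptotic [] [] [] = Asymptotic-1
  pV-asymptotic {suc d} (u ∷ y) (v ∷ b) (w ∷ c) =
    Asymptotic-cong (λ M → interchange (k !) ((k !) ^ d) (pJ k M (toℕ u) (toℕ v) (toℕ w)) (pV M y b c))
      (Asymptotic-* (pJ-asymptotic k (toℕ≤k u) (toℕ≤k v) (toℕ≤k w)) (pV-asymptotic y b c))
    where
      interchange : ∀ a p x z → (a * x) * (p * z) ≡ (a * p) * (x * z)
      interchange = solve-∀

  diag-lead : ∀ {d} → Pt k d → Pt k d → ℕ
  diag-lead [] [] = 1
  diag-lead (u ∷ y) (v ∷ a) = ((k ∸ toℕ u) C (k ∸ toℕ v)) * lead-C k (toℕ v) * diag-lead y a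

  pV-lead-diag : ∀ {d} (y a : Pt k d) → pV-lead y a a ≡ diag-lead y a
  pV-lead-diag [] [] = refl
  pV-lead-diag (u ∷ y) (v ∷ a) = cong₂ _*_ (pJ-lead-diag k (toℕ u) (toℕ≤k v)) (pV-lead-diag y a)

  C[k∸u,k∸v]-pos : ∀ (u v : Fin (suc k)) → toℕ u ≤ toℕ v → 1 ≤ (k ∸ toℕ u) C (k ∸ toℕ v)
  C[k∸u,k∸v]-pos _ _ u≤v = C-pos (∸-monoʳ-≤ k u≤v)

  diag-lead-pos : ∀ {d} (y a : Pt k d) → y ≤v a → 1 ≤ diag-lead y a
  diag-lead-pos [] [] _ = ≤-refl
  diag-lead-pos (u ∷ y) (v ∷ a) u∷y≤v∷a =
    *-mono-≤ (*-mono-≤ (C[k∸u,k∸v]-pos u v (≤v-head u∷y≤v∷a)) (lead-C-pos k (toℕ≤k v)))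
             (diag-lead-pos y a (≤v-tail u∷y≤v∷a))

  diag-lead-pos⁻¹ : ∀ {d} (y a : Pt k d) → 1 ≤ diag-lead y a → y ≤v a
  diag-lead-pos⁻¹ (u ∷ y) (v ∷ a) D≥1 =
    let (XQ≥1 , Dy≥1) = *-pos⁻¹ (((k ∸ toℕ u) C (k ∸ toℕ v)) * lead-C k (toℕ v)) (diag-lead y a) D≥1
        (X≥1 , _) = *-pos⁻¹ ((k ∸ toℕ u) C (k ∸ toℕ v)) (lead-C k (toℕ v)) XQ≥1
    in ≤v-∷ (∸-cancelʳ-≤ (toℕ≤k u) (C-pos⁻¹ X≥1)) (diag-lead-pos⁻¹ y a Dy≥1)

  diag-lead-antitone : ∀ {d} (y a : Pt k d) → y ≤v a → diag-lead a a ≤ diag-lead y a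
  diag-lead-antitone [] [] _ = ≤-refl
  diag-lead-antitone (u ∷ y) (v ∷ a) u∷y≤v∷a =
    *-mono-≤ (*-monoˡ-≤ (lead-C k (toℕ v)) (subst (_≤ (k ∸ toℕ u) C (k ∸ toℕ v)) (sym (nCn≡1 (k ∸ toℕ v)))
                                                   (C[k∸u,k∸v]-pos u v (≤v-head u∷y≤v∷a))))
             (diag-lead-antitone y a (≤v-tail u∷y≤v∷a))

  diag-lead-tight : ∀ {d} (y a : Pt k d) → y ≤v a → diag-lead y a ≤ diag-lead a a
                  → ∀ i → (k ∸ toℕ (lookup y i)) C (k ∸ toℕ (lookup a i)) ≡ 1
  diag-lead-tight (u ∷ y) (v ∷ a) u∷y≤v∷a D≤Da = tight
    where
      Q = lead-C k (toℕ v)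
      XQDy≤QDa : ((k ∸ toℕ u) C (k ∸ toℕ v)) * Q * diag-lead y a ≤ Q * diag-lead a a
      XQDy≤QDa = ≤-trans D≤Da (≤-reflexive (trans (cong (λ z → z * Q * diag-lead a a) (nCn≡1 (k ∸ toℕ v)))
                                                  (cong (_* diag-lead a a) (*-identityˡ Q))))
      both = *-≤-tight (C[k∸u,k∸v]-pos u v (≤v-head u∷y≤v∷a)) (lead-C-pos k (toℕ≤k v))
               (diag-lead-pos a a (≤v-refl a)) (diag-lead-antitone y a (≤v-tail u∷y≤v∷a)) XQDy≤QDa
      tight : ∀ i → (k ∸ toℕ (lookup (u ∷ y) i)) C (k ∸ toℕ (lookup (v ∷ a) i)) ≡ 1
      tight fzero = proj₁ both
      tight (fsuc i) = diag-lead-tight y a (≤v-tail u∷y≤v∷a) (proj₂ both) i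

  module _ {d : ℕ} (α : Subset k d) where

    pS-lead-term : Pt k d → Pt k d → Pt k d → ℕ
    pS-lead-term y b c =
      if α b then (if α c then (if does (wt⊓ b c ≟ wtS α) then pV-lead y b c else 0) else 0) else 0

    -- the coefficient of M^(wt α) in (k!)^d · p^y_{α,α}(M)
    pS-lead : Pt k d → ℕ
    pS-lead y = sum (map (λ b → sum (map (pS-lead-term y b) (allPts k d))) (allPts k d))

    pS-asymptotic : ∀ y → Asymptotic (λ M → (k !) ^ d * pS M y α α) (wtS α) (pS-lead y)
    pS-asymptotic y =
      Asymptotic-cong (λ M → sym (factor-out M))
        (Asymptotic-sum _ _ (λ b → Asymptotic-sum _ _ (term b) (allPts k d)) (allPts k d))
      where
        K = (k !) ^ d
        term : ∀ b c → Asymptotic (λ M → K * (if α b then (if α c then pV M y b c else 0) else 0))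
                                  (wtS α) (pS-lead-term y b c)
        term b c = Asymptotic-cong
          (λ M → sym (trans (*-if K (α b) _) (cong (λ z → if α b then z else 0) (*-if K (α c) _))))
          (Asymptotic-if (α b) λ b∈α → Asymptotic-if (α c) λ _ →
            Asymptotic-pad (wtS α) (pV-asymptotic y b c) (≤-trans (wt⊓≤wtˡ b c) (wt≤wtS α b∈α)))
        factor-out : ∀ M → K * pS M y α α
          ≡ sum (map (λ b → sum (map (λ c → K * (if α b then (if α c then pV M y b c else 0) else 0))
                                      (allPts k d))) (allPts k d))
        factor-out M = trans (*-distribˡ-sum K _ (allPts k d))
                             (cong sum (map-cong (λ b → *-distribˡ-sum K _ (allPts k d)) (allPts k d)))

    pS-lead-term-diag : ∀ y {a} → a ∈* α → pS-lead-term y a a ≡ diag-lead y a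
    pS-lead-term-diag y {a} (a∈α , wt≡) =
      trans (if-true a∈α) (trans (if-true a∈α)
        (trans (if-true (dec-true (wt⊓ a a ≟ wtS α) (trans (wt⊓-idem a) wt≡))) (pV-lead-diag y a)))

    pS-lead-term-pos : ∀ y b c → 1 ≤ pS-lead-term y b c → b ∈* α × b ≡ c × y ≤v b
    pS-lead-term-pos y b c t≥1 =
      let (b∈α , t₁≥1) = if-pos (α b) t≥1
          (c∈α , t₂≥1) = if-pos (α c) t₁≥1
          (wt⊓≡ , p≥1) = if-dec-pos (wt⊓ b c ≟ wtS α) t₂≥1
          wtb≡ = ≤-antisym (wt≤wtS α b∈α) (subst (_≤ wt b) wt⊓≡ (wt⊓≤wtˡ b c))
          wtc≡ = ≤-antisym (wt≤wtS α c∈α) (subst (_≤ wt c) wt⊓≡ (wt⊓≤wtʳ b c))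
          b≡c = ≤v∧wt≡⇒≡ b c (wt⊓≡wtˡ⇒≤v b c (trans wt⊓≡ (sym wtb≡))) (trans wtb≡ (sym wtc≡))
          diag≥1 = subst (1 ≤_) (pV-lead-diag y b) (subst (λ z → 1 ≤ pV-lead y b z) (sym b≡c) p≥1)
      in (b∈α , wtb≡) , b≡c , diag-lead-pos⁻¹ y b diag≥1

    private
      open PtCounting
      pts = allPts k d

      listed : ∀ a → 1 ≤ count a pts
      listed a = ≤-reflexive (sym (count-allPts k d a))

      row : Pt k d → Pt k d → ℕ
      row y b = sum (map (pS-lead-term y b) pts)

      ≤-row : ∀ y {a} → a ∈* α → diag-lead y a ≤ row y a
      ≤-row y {a} a∈α* = subst (_≤ row y a) (pS-lead-term-diag y a∈α*) (≤-sum-map (pS-lead-term y a) pts (listed a))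

    ≤-pS-lead : ∀ y {a} → a ∈* α → diag-lead y a ≤ pS-lead y
    ≤-pS-lead y {a} a∈α* = ≤-trans (≤-row y a∈α*) (≤-sum-map (row y) pts (listed a))

    +-≤-pS-lead : ∀ y {a a'} → a ∈* α → a' ∈* α → a' ≢ a → diag-lead y a + diag-lead y a' ≤ pS-lead y
    +-≤-pS-lead y {a} {a'} a∈α* a'∈α* a'≢a =
      ≤-trans (+-mono-≤ (≤-row y a∈α*) (≤-row y a'∈α*)) (+-≤-sum-map (row y) pts (listed a) (listed a') a'≢a)

    pS-lead-pos⁻¹ : ∀ y → 1 ≤ pS-lead y → ∃[ b ] (b ∈* α × y ≤v b)
    pS-lead-pos⁻¹ y lead≥1 =
      let (b , row≥1) = sum-map-pos (row y) pts lead≥1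
          (c , t≥1) = sum-map-pos (pS-lead-term y b) pts row≥1
          (b∈α* , _ , y≤b) = pS-lead-term-pos y b c t≥1
      in b , b∈α* , y≤b

    pS-lead-top : ∀ {a} → a ∈* α → pS-lead a ≡ diag-lead a a
    pS-lead-top {a} a∈α* =
      trans (sum-map-point (row a) pts (count-allPts k d a) other-rows)
        (trans (sum-map-point (pS-lead-term a a) pts (count-allPts k d a) other-columns) (pS-lead-term-diag a a∈α*))
      where
        other-rows : ∀ b → b ≢ a → row a b ≡ 0
        other-rows b b≢a = sum-map-0 (pS-lead-term a b) pts λ c → n<1⇒n≡0 (≰⇒> λ t≥1 →
          let ((_ , wtb≡) , _ , a≤b) = pS-lead-term-pos a b c t≥1
          in b≢a (sym (≤v∧wt≡⇒≡ a b a≤b (trans (proj₂ a∈α*) (sym wtb≡)))))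
        other-columns : ∀ c → c ≢ a → pS-lead-term a a c ≡ 0
        other-columns c c≢a = n<1⇒n≡0 (≰⇒> λ t≥1 → c≢a (sym (proj₁ (proj₂ (pS-lead-term-pos a a c t≥1)))))

PolyEq⇒pS-lead≡ : ∀ {k d} (α : Subset k d) {y y'} → PolyEq y y' α α → pS-lead α y ≡ pS-lead α y'
PolyEq⇒pS-lead≡ {k} {d} α {y} {y'} poly-eq =
  Asymptotic-unique (k + k) (λ M 2k≤M → cong ((k !) ^ d *_) (poly-eq M 2k≤M)) (pS-asymptotic α y) (pS-asymptotic α y')

-- A minimal block

module MinimalBlock {k d n : ℕ} (k≥1 : 1 ≤ k) (𝔖 : Fin n → Subset k d) (partition : IsPartition 𝔖)
  (i : Fin n) (minimal : Minimal 𝔖 i)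
  (invariant : ∀ j {y y'} → y ∈S 𝔖 j → y' ∈S 𝔖 j → pS-lead (𝔖 i) y ≡ pS-lead (𝔖 i) y') where

  open IsPartition partition using (nonempty; covers)

  α : Subset k d
  α = 𝔖 i

  top : ∃[ a ] a ∈* α
  top = wtS-attained α (proj₂ (nonempty i))

  -- every point of a block whose leading coefficient is positive lies below α*, so such a block is ⪯ α
  D⇒ : ∀ x → x ∈D α → x ∈S α ⊎ x ≡ zeros
  D⇒ x (a , a∈α* , x≤a) with x ≟ₚ zeros | covers x
  ... | yes x≡zeros | _ = inj₂ x≡zeros
  ... | no x≢zeros | j , x∈j = inj₁ (trans (sym (proj₂ minimal j nonzero below x)) x∈j)
    where
      nonzero : ¬ IsZeroSet (𝔖 j)
      nonzero zero-set = x≢zeros (Equivalence.to (zero-set x) x∈j)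
      below : 𝔖 j ⪯ α
      below x' x'∈j =
        let (b , b∈α* , x'≤b) = pS-lead-pos⁻¹ α x' (subst (1 ≤_) (invariant j x∈j x'∈j)
                                  (≤-trans (diag-lead-pos x a x≤a) (≤-pS-lead α x a∈α*)))
        in b , proj₁ b∈α* , x'≤b

  D⇐ : ∀ x → x ∈S α ⊎ x ≡ zeros → x ∈D α
  D⇐ x (inj₁ x∈α) =
    let (a , a∈α*) = top
    in pS-lead-pos⁻¹ α x (subst (1 ≤_) (invariant i (proj₁ a∈α*) x∈α)
         (≤-trans (diag-lead-pos a a (≤v-refl a)) (≤-pS-lead α a a∈α*)))
  D⇐ x (inj₂ refl) = let (a , a∈α*) = top in a , a∈α* , zeros-≤v a

  unit∈α : ∀ {a t} → a ∈* α → InSupp a t → unit k≥1 t ∈S α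
  unit∈α {a} {t} a∈α* t∈supp with D⇒ (unit k≥1 t) (a , a∈α* , unit-≤v k≥1 a t∈supp)
  ... | inj₁ unit∈α = unit∈α
  ... | inj₂ unit≡zeros = ⊥-elim (unit≢zeros k≥1 t unit≡zeros)

  pS-lead-unit : ∀ {a t} → a ∈* α → InSupp a t → pS-lead α (unit k≥1 t) ≡ diag-lead a a
  pS-lead-unit a∈α* t∈supp = trans (invariant i (unit∈α a∈α* t∈supp) (proj₁ a∈α*)) (pS-lead-top α a∈α*)

  entry-cases : ∀ {a t} → a ∈* α → InSupp a t
              → ∀ s → toℕ (lookup a s) ≡ toℕ (lookup (unit k≥1 t) s) ⊎ toℕ (lookup a s) ≡ k
  entry-cases {a} {t} a∈α* t∈supp s =
    C[k∸u,k∸x]≡1⇒ (unit-≤v k≥1 a t∈supp s) (toℕ≤k (lookup a s))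
      (diag-lead-tight (unit k≥1 t) a (unit-≤v k≥1 a t∈supp)
         (≤-trans (≤-pS-lead α (unit k≥1 t) a∈α*) (≤-reflexive (pS-lead-unit a∈α* t∈supp))) s)

  disjoint-supports : ∀ {a a'} → a ∈* α → a' ∈* α → a ≢ a' → ∀ t → InSupp a t → ¬ InSupp a' t
  disjoint-supports {a} {a'} a∈α* a'∈α* a≢a' t t∈supp t∈supp' = <-irrefl refl (begin-strict
    diag-lead a a                  <⟨ m<m+n (diag-lead a a) (diag-lead-pos e a' (unit-≤v k≥1 a' t∈supp')) ⟩
    diag-lead a a + diag-lead e a' ≤⟨ +-monoˡ-≤ _ (diag-lead-antitone e a (unit-≤v k≥1 a t∈supp)) ⟩
    diag-lead e a + diag-lead e a' ≤⟨ +-≤-pS-lead α e a∈α* a'∈α* (λ a'≡a → a≢a' (sym a'≡a)) ⟩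
    pS-lead α e                    ≡⟨ pS-lead-unit a∈α* t∈supp ⟩
    diag-lead a a                  ∎)
    where
      open ≤-Reasoning
      e = unit k≥1 t

  -- an entry 1 of a ∈ α* forces wt a = 1, since any other support coordinate t makes it 0 or k
  0-or-k : wtS α ≢ 1 → ∀ {a} → a ∈* α → ∀ s → toℕ (lookup a s) ≡ 0 ⊎ toℕ (lookup a s) ≡ k
  0-or-k wtS≢1 {a} a∈α* s with toℕ (lookup a s) ≟ 0
  ... | yes as≡0 = inj₁ as≡0
  ... | no as≢0 with entry-cases a∈α* (n≢0⇒n>0 as≢0) s
  ...   | inj₂ as≡k = inj₂ as≡k
  ...   | inj₁ as≡1 with wt≡entry⊎InSupp a s
  ...     | inj₁ wt≡as = ⊥-elim (wtS≢1 (trans (sym (proj₂ a∈α*)) (trans wt≡as (trans as≡1 (unit-at k≥1 s)))))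
  ...     | inj₂ (t , t≢s , t∈supp) with entry-cases a∈α* t∈supp s
  ...       | inj₁ as≡0 = ⊥-elim (as≢0 (trans as≡0 (unit-off k≥1 (λ s≡t → t≢s (sym s≡t)))))
  ...       | inj₂ as≡k = inj₂ as≡k

  suppSize≡ : ∀ {a a'} → a ∈* α → a' ∈* α → suppSize a ≡ suppSize a'
  suppSize≡ {a} {a'} a∈α* a'∈α* with wtS α ≟ 1
  ... | yes wtS≡1 = trans (wt≡1⇒suppSize≡1 a (trans (proj₂ a∈α*) wtS≡1))
                          (sym (wt≡1⇒suppSize≡1 a' (trans (proj₂ a'∈α*) wtS≡1)))
  ... | no wtS≢1 = *-cancelˡ-≡ (suppSize a) (suppSize a') k {{>-nonZero k≥1}} (begin
    k * suppSize a  ≡⟨ 0-or-k⇒wt≡k*suppSize a (0-or-k wtS≢1 a∈α*) ⟨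
    wt a            ≡⟨ trans (proj₂ a∈α*) (sym (proj₂ a'∈α*)) ⟩
    wt a'           ≡⟨ 0-or-k⇒wt≡k*suppSize a' (0-or-k wtS≢1 a'∈α*) ⟩
    k * suppSize a' ∎)
    where open ≡-Reasoning

  wtS≡1⊎0-or-k : wtS α ≡ 1 ⊎ (∀ a → a ∈* α → ∀ t → toℕ (lookup a t) ≡ 0 ⊎ toℕ (lookup a t) ≡ k)
  wtS≡1⊎0-or-k with wtS α ≟ 1
  ... | yes wtS≡1 = inj₁ wtS≡1
  ... | no wtS≢1 = inj₂ (λ a a∈α* → 0-or-k wtS≢1 a∈α*)

corollary3p4 : (k d : ℕ) → 1 ≤ k → 1 ≤ d
    → (m₀ : ℕ) → ValidM0 k d m₀ → (m : ℕ) → m₀ ≤ m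
    → (n : ℕ) (𝔖 : Fin n → Subset k d) → IsPartition 𝔖
    → (∃[ z ] IsZeroSet (𝔖 z))
    → (∀ (i j l : Fin n) (a a' : Pt k d) → a ∈S 𝔖 i → a' ∈S 𝔖 i
         → pS m a (𝔖 j) (𝔖 l) ≡ pS m a' (𝔖 j) (𝔖 l))
    → (i : Fin n) → Minimal 𝔖 i
    → (∀ x → (x ∈D 𝔖 i) ⇔ (x ∈S 𝔖 i ⊎ x ≡ zeros))
      × (∀ a a' → a ∈* 𝔖 i → a' ∈* 𝔖 i
           → (a ≢ a' → ∀ t → InSupp a t → ¬ InSupp a' t)
             × suppSize a ≡ suppSize a')
      × (wtS (𝔖 i) ≡ 1
         ⊎ (∀ a → a ∈* 𝔖 i → ∀ t → toℕ (lookup a t) ≡ 0 ⊎ toℕ (lookup a t) ≡ k))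
corollary3p4 k d k≥1 _ m₀ (_ , polynomial) m m₀≤m n 𝔖 partition _ p-invariant i minimal =
    (λ x → mk⇔ (D⇒ x) (D⇐ x))
  , (λ a a' a∈α* a'∈α* → disjoint-supports a∈α* a'∈α* , suppSize≡ a∈α* a'∈α*)
  , wtS≡1⊎0-or-k
  where
    lead-invariant : ∀ j {y y'} → y ∈S 𝔖 j → y' ∈S 𝔖 j → pS-lead (𝔖 i) y ≡ pS-lead (𝔖 i) y'
    lead-invariant j {y} {y'} y∈j y'∈j =
      PolyEq⇒pS-lead≡ (𝔖 i) {y} {y'} (polynomial m m₀≤m (𝔖 i) (𝔖 i) y y' (p-invariant j i i y y' y∈j y'∈j))
    open MinimalBlock k≥1 𝔖 partition i minimal lead-invariant
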